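{- (1) Every BJ-tree $(N,\leq)$ has a structuring $\mathcal U$ making $(N,\leq,\mathcal U)$ an SBJ-tree. (2) The class of structures $S(J)$ for SBJ-trees $J$ is monadic second-order definable: there is an MS sentence over $\{\leq,N_0,N_1\}$ whose countable models are exactly the structures isomorphic to $S(J)$ for some SBJ-tree $J$.
   Context: All sets are finite or countable. A join-tree is $(N,\leq)$ with $\leq$ a partial order on a countable set such that each $\{y\mid y\geq x\}$ is linearly ordered and every two nodes have a join $x\sqcup y$. For a node $x$, its directions are the classes of $\{z\mid z<x\}$ under $z\sim y$ iff $z\sqcup y<x$; its degree is the number of directions; a BJ-tree is a join-tree whose nodes have degree at most 2. A line is a linearly ordered convex subset; the top $\widehat X$ of a nonempty $X$ is its least strict upper bound, if it exists. A structuring of a join-tree is a set $\mathcal U$ of nonempty lines partitioning $N$ such that exactly one $A\in\mathcal U$ (the axis) is upwards closed, every other $U\in\mathcal U$ has a top, and for every $x$ the sequence $y_0=x$, $y_{i+1}=\widehat{U(y_i)}$ ($U(y)$ the line containing $y$, stopping when $U(y_i)=A$) is finite; its number of steps is the depth of $x$. An SBJ-tree is $(N,\leq,\mathcal U)$ with $(N,\leq)$ a BJ-tree and $\mathcal U$ a structuring such that (i) if the axis has a least element, its degree is 0 or 1; (ii) each node is the top of at most one line of $\mathcal U$. For such $J$, $S(J)=(N,\leq,N_0,N_1)$ where $N_0$ is the set of nodes of even depth and $N_1=N\setminus N_0$. MS logic extends first-order logic with set variables and atomic formulas $x\in X$. -}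

module Defs where

open import Level using (Level; Lift; 0ℓ) renaming (suc to lsuc)
open import Data.Nat using (ℕ; zero; suc)
open import Data.Fin using (Fin)
import Data.Fin as F
open import Data.Product using (Σ; ∃; _×_; _,_)
open import Data.Sum using (_⊎_)
open import Relation.Nullary using (¬_)
open import Relation.Binary.PropositionalEquality using (_≡_; _≢_)
open import Function.Bundles using (_↣_; _↔_; _⇔_; Inverse)

module _ {N : Set} (_≤_ : N → N → Set) where

  Lt : N → N → Set
  Lt x y = (x ≤ y) × (x ≢ y)

  IsJoin : N → N → N → Set
  IsJoin x y j = (x ≤ j) × (y ≤ j) × (∀ w → x ≤ w → y ≤ w → j ≤ w)

  SameDir : N → N → N → Set
  SameDir x z y = ∃ λ j → IsJoin z y j × Lt j x

  -- degree of x is at most 2: the relation "same direction" on the nodes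
  -- below x has at most 2 classes, i.e. there are no three pairwise
  -- inequivalent nodes below x
  DegAtMost2 : N → Set
  DegAtMost2 x = ¬ (Σ N λ z₁ → Σ N λ z₂ → Σ N λ z₃ →
      Lt z₁ x × Lt z₂ x × Lt z₃ x ×
      ¬ SameDir x z₁ z₂ × ¬ SameDir x z₁ z₃ × ¬ SameDir x z₂ z₃)

  DegAtMost1 : N → Set
  DegAtMost1 x = ¬ (Σ N λ z₁ → Σ N λ z₂ →
      Lt z₁ x × Lt z₂ x × ¬ SameDir x z₁ z₂)

  IsLine : (N → Set) → Set
  IsLine L = (∀ x y → L x → L y → (x ≤ y) ⊎ (y ≤ x))
           × (∀ x y z → L x → L z → x ≤ y → y ≤ z → L y)

  UpClosed : (N → Set) → Set
  UpClosed L = ∀ x y → L x → x ≤ y → L y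

  StrictUB : (N → Set) → N → Set
  StrictUB X t = ∀ x → X x → Lt x t

  IsTop : (N → Set) → N → Set
  IsTop X t = StrictUB X t × (∀ t′ → StrictUB X t′ → t ≤ t′)

  IsLeast : (N → Set) → N → Set
  IsLeast X m = X m × (∀ x → X x → m ≤ x)

  -- Depth x n : the sequence y₀ = x, y_{i+1} = top of U(yᵢ) reaches the
  -- axis after exactly n steps.
  data Depth {I : Set} (U : I → N → Set) (a : I) : N → ℕ → Set where
    atAxis : ∀ {x} → U a x → Depth U a x zero
    step   : ∀ {x i t n} → U i x → i ≢ a → IsTop (U i) t →
             Depth U a t n → Depth U a x (suc n)

record JoinTree : Set₁ where
  field
    N         : Set
    _≤_       : N → N → Set
    countable : N ↣ ℕ
    inhabited : N
    ≤-refl    : ∀ x → x ≤ x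
    ≤-trans   : ∀ {x y z} → x ≤ y → y ≤ z → x ≤ z
    ≤-antisym : ∀ {x y} → x ≤ y → y ≤ x → x ≡ y
    upLinear  : ∀ x y z → x ≤ y → x ≤ z → (y ≤ z) ⊎ (z ≤ y)
    joins     : ∀ x y → ∃ λ j → IsJoin _≤_ x y j

IsBJ : JoinTree → Set
IsBJ T = ∀ x → DegAtMost2 _≤_ x
  where open JoinTree T

record Structuring (T : JoinTree) : Set₁ where
  open JoinTree T
  field
    I          : Set
    U          : I → N → Set
    lines      : ∀ i → IsLine _≤_ (U i)
    nonempty   : ∀ i → ∃ λ x → U i x
    cover      : ∀ x → ∃ λ i → U i x
    disjoint   : ∀ {i j x} → U i x → U j x → i ≡ j
    axis       : I
    axisUp     : UpClosed _≤_ (U axis)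
    axisUnique : ∀ i → UpClosed _≤_ (U i) → i ≡ axis
    tops       : ∀ i → i ≢ axis → ∃ λ t → IsTop _≤_ (U i) t
    finiteDepth : ∀ x → ∃ λ n → Depth _≤_ U axis x n

record IsSBJ (T : JoinTree) (𝒰 : Structuring T) : Set₁ where
  open JoinTree T
  open Structuring 𝒰
  field
    axisLeastDeg : ∀ m → IsLeast _≤_ (U axis) m → DegAtMost1 _≤_ m
    topOfOne     : ∀ t i j → IsTop _≤_ (U i) t → IsTop _≤_ (U j) t → i ≡ j

record SBJTree : Set₁ where
  field
    tree  : JoinTree
    isBJ  : IsBJ tree
    strct : Structuring tree
    isSBJ : IsSBJ tree strct

record Str : Set₁ where
  field
    C         : Set
    countable : C ↣ ℕ
    R         : C → C → Set
    P₀        : C → Set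
    P₁        : C → Set

record _≅_ (A B : Str) : Set where
  private
    module A = Str A
    module B = Str B
  field
    bij  : A.C ↔ B.C
  open Inverse bij using (to)
  field
    presR  : ∀ x y → A.R x y ⇔ B.R (to x) (to y)
    presP₀ : ∀ x → A.P₀ x ⇔ B.P₀ (to x)
    presP₁ : ∀ x → A.P₁ x ⇔ B.P₁ (to x)

data Even : ℕ → Set where
  even0  : Even zero
  even+2 : ∀ {n} → Even n → Even (suc (suc n))

S : SBJTree → Str
S J = record
  { C = N ; countable = countable ; R = _≤_
  ; P₀ = N₀ ; P₁ = λ x → ¬ N₀ x }
  where
    open SBJTree J
    open JoinTree tree
    open Structuring strct
    N₀ : N → Set
    N₀ x = ∃ λ n → Depth _≤_ U axis x n × Even n

-- Monadic second-order logic over {≤, N₀, N₁}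
-- Form n m : formulas with n free first-order and m free set variables
-- (de Bruijn indices)

data Form (n m : ℕ) : Set where
  _≐_ _≼_      : Fin n → Fin n → Form n m
  inN₀ inN₁    : Fin n → Form n m
  _∈ˢ_         : Fin n → Fin m → Form n m
  ¬ᶠ_          : Form n m → Form n m
  _∧ᶠ_ _∨ᶠ_ _⇒ᶠ_ : Form n m → Form n m → Form n m
  ∃¹ ∀¹        : Form (suc n) m → Form n m
  ∃² ∀²        : Form n (suc m) → Form n m

Sentence : Set
Sentence = Form 0 0

extend : ∀ {k} {A : Set₁} → (Fin k → A) → A → Fin (suc k) → A
extend ρ a F.zero    = a
extend ρ a (F.suc i) = ρ i

extend₀ : ∀ {k} {A : Set} → (Fin k → A) → A → Fin (suc k) → A
extend₀ ρ a F.zero    = a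
extend₀ ρ a (F.suc i) = ρ i

Sat : (M : Str) → ∀ {n m} → Form n m →
      (Fin n → Str.C M) → (Fin m → (Str.C M → Set)) → Set₁
Sat M (i ≐ j)   ρ σ = Lift _ (ρ i ≡ ρ j)
Sat M (i ≼ j)   ρ σ = Lift _ (Str.R M (ρ i) (ρ j))
Sat M (inN₀ i)  ρ σ = Lift _ (Str.P₀ M (ρ i))
Sat M (inN₁ i)  ρ σ = Lift _ (Str.P₁ M (ρ i))
Sat M (i ∈ˢ X)  ρ σ = Lift _ (σ X (ρ i))
Sat M (¬ᶠ φ)    ρ σ = ¬ Sat M φ ρ σ
Sat M (φ ∧ᶠ ψ)  ρ σ = Sat M φ ρ σ × Sat M ψ ρ σ
Sat M (φ ∨ᶠ ψ)  ρ σ = Sat M φ ρ σ ⊎ Sat M ψ ρ σ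
Sat M (φ ⇒ᶠ ψ)  ρ σ = Sat M φ ρ σ → Sat M ψ ρ σ
Sat M (∃¹ φ)    ρ σ = Σ (Str.C M) λ x → Sat M φ (extend₀ ρ x) σ
Sat M (∀¹ φ)    ρ σ = (x : Str.C M) → Sat M φ (extend₀ ρ x) σ
Sat M (∃² φ)    ρ σ = Σ (Str.C M → Set) λ X → Sat M φ ρ (extend σ X)
Sat M (∀² φ)    ρ σ = (X : Str.C M → Set) → Sat M φ ρ (extend σ X)

Models : Str → Sentence → Set₁
Models M φ = Sat M φ (λ ()) (λ ())

-- (1) Enumerate the nodes. The guide of a node m is the node of least code below m, and a
-- node y < m breaks at m when y and the guide lie in different directions at m. Two comparable
-- nodes lie on the same line when the lower one does not break up to the upper one. The nodes
-- that never break form the axis and the top of the line of y is the least node where y breaks.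
-- The codes of the guides strictly decrease along tops, which makes depths finite; three
-- directions at a top would contradict degree at most 2, so a top determines its line; and the
-- guide of the least node of the axis would itself lie on the axis, so that node is minimal.
--
-- (2) The top of a line has depth one more than the line, so in S(J) the colour changes exactly
-- at tops: the lines are the maximal monochrome intervals and the axis consists of the nodes
-- whose up-set is one such interval, all first-order definable. The sentence says that these
-- definable lines satisfy the conditions of an SBJ-tree with tops changing colour and the axis
-- coloured N₀; finite depth is its one monadic conjunct, induction along tops. Conversely, in a
-- model the definable lines form a structuring whose depth parity is the given colouring.
module Submission where

open import Defs
open import Level using (Lift; lift; lower; 0ℓ) renaming (suc to lsuc)
open import Data.Nat using (ℕ; zero; suc; s≤s; _∸_) renaming (_≤_ to _≤ℕ_; _<_ to _<ℕ_)
import Data.Nat.Properties as ℕ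
open import Data.Fin using (Fin) renaming (zero to fzero; suc to fsuc)
open import Data.Product using (Σ; ∃; _×_; _,_; proj₁; proj₂; swap)
open import Data.Sum using (_⊎_; inj₁; inj₂)
import Data.Sum as Sum
open import Data.Empty using (⊥-elim)
open import Data.Unit using (⊤; tt)
open import Relation.Nullary using (¬_; Dec; yes; no)
open import Relation.Nullary.Decidable using (map′; decidable-stable)
open import Relation.Binary.PropositionalEquality using (_≡_; _≢_; refl; sym; trans; cong; cong₂; subst)
open import Function.Bundles using (Injection; Inverse; _⇔_; mk⇔; Equivalence)
open import Function.Construct.Identity using (⇔-id; ↔-id)
open import Function.Construct.Symmetry using (⇔-sym)
open import Function.Construct.Composition using (_⇔-∘_)
open import Function.Related.TypeIsomorphisms using (¬-cong-⇔; →-cong-⇔)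
open import Data.Product.Function.NonDependent.Propositional using (_×-⇔_)
open import Data.Sum.Function.Propositional using (_⊎-⇔_)
open import Axiom.ExcludedMiddle using (ExcludedMiddle)
open import Axiom.UniquenessOfIdentityProofs.WithK using (uip)

module Classical (em : ExcludedMiddle (lsuc 0ℓ)) where

  dec : (P : Set) → Dec P
  dec P = map′ lower lift em

  dne : {P : Set} → ¬ ¬ P → P
  dne = decidable-stable (dec _)

  argmin : {A : Set} (f : A → ℕ) (P : A → Set) {a : A} → P a →
           Σ A λ b → P b × (∀ c → P c → f b ≤ℕ f c)
  argmin {A} f P {a} pa = go (suc (f a)) a ℕ.≤-refl pa
    where
    go : ∀ k a → f a <ℕ k → P a → Σ A λ b → P b × (∀ c → P c → f b ≤ℕ f c)
    go (suc k) a fa<1+k pa with dec (∃ λ c → P c × f c <ℕ f a)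
    ... | yes (c , pc , fc<fa) = go k c (ℕ.<-≤-trans fc<fa (ℕ.≤-pred fa<1+k)) pc
    ... | no none = a , pa , λ c pc → ℕ.≮⇒≥ λ fc<fa → none (c , pc , fc<fa)

module JoinTreeProperties (T : JoinTree) where
  open JoinTree T public

  _<_ : N → N → Set
  _<_ = Lt _≤_

  code : N → ℕ
  code = Injection.to countable

  code-injective : ∀ {x y} → code x ≡ code y → x ≡ y
  code-injective = Injection.injective countable

  <-irrefl : ∀ {x} → ¬ x < x
  <-irrefl (_ , x≢x) = x≢x refl

  <⇒≱ : ∀ {x y} → x < y → ¬ y ≤ x
  <⇒≱ (x≤y , x≢y) y≤x = x≢y (≤-antisym x≤y y≤x)

  ≤-<-trans : ∀ {x y z} → x ≤ y → y < z → x < z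
  ≤-<-trans x≤y (y≤z , y≢z) = ≤-trans x≤y y≤z , λ { refl → y≢z (≤-antisym y≤z x≤y) }

  <-≤-trans : ∀ {x y z} → x < y → y ≤ z → x < z
  <-≤-trans (x≤y , x≢y) y≤z = ≤-trans x≤y y≤z , λ { refl → x≢y (≤-antisym x≤y y≤z) }

  _⊔_ : N → N → N
  x ⊔ y = proj₁ (joins x y)

  x≤x⊔y : ∀ x y → x ≤ (x ⊔ y)
  x≤x⊔y x y = proj₁ (proj₂ (joins x y))

  y≤x⊔y : ∀ x y → y ≤ (x ⊔ y)
  y≤x⊔y x y = proj₁ (proj₂ (proj₂ (joins x y)))

  ⊔-least : ∀ {x y w} → x ≤ w → y ≤ w → (x ⊔ y) ≤ w
  ⊔-least {x} {y} = proj₂ (proj₂ (proj₂ (joins x y))) _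

  ⊔-isJoin : ∀ x y → IsJoin _≤_ x y (x ⊔ y)
  ⊔-isJoin x y = proj₂ (joins x y)

  sameDir⇒⊔< : ∀ {m x y} → SameDir _≤_ m x y → (x ⊔ y) < m
  sameDir⇒⊔< (j , (x≤j , y≤j , _) , j<m) = ≤-<-trans (⊔-least x≤j y≤j) j<m

  sameDir-ub : ∀ {m x y w} → x ≤ w → y ≤ w → w < m → SameDir _≤_ m x y
  sameDir-ub x≤w y≤w w<m = _ , ⊔-isJoin _ _ , ≤-<-trans (⊔-least x≤w y≤w) w<m

  sameDir-sym : ∀ {m x y} → SameDir _≤_ m x y → SameDir _≤_ m y x
  sameDir-sym sd = sameDir-ub (y≤x⊔y _ _) (x≤x⊔y _ _) (sameDir⇒⊔< sd)

  sameDir-trans : ∀ {m x y z} → SameDir _≤_ m x y → SameDir _≤_ m y z → SameDir _≤_ m x z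
  sameDir-trans {x = x} {y} {z} sxy syz with upLinear y (x ⊔ y) (y ⊔ z) (y≤x⊔y x y) (x≤x⊔y y z)
  ... | inj₁ xy≤yz = sameDir-ub (≤-trans (x≤x⊔y x y) xy≤yz) (y≤x⊔y y z) (sameDir⇒⊔< syz)
  ... | inj₂ yz≤xy = sameDir-ub (x≤x⊔y x y) (≤-trans (y≤x⊔y y z) yz≤xy) (sameDir⇒⊔< sxy)

  sameDir-downward : ∀ {m x y d} → x ≤ y → SameDir _≤_ m y d → SameDir _≤_ m x d
  sameDir-downward x≤y sd = sameDir-ub (≤-trans x≤y (x≤x⊔y _ _)) (y≤x⊔y _ _) (sameDir⇒⊔< sd)

  sameDir-upward : ∀ {m x y d} → y ≤ x → x < m → SameDir _≤_ m y d → SameDir _≤_ m x d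
  sameDir-upward {y = y} {d} y≤x x<m sd with upLinear y _ (y ⊔ d) y≤x (x≤x⊔y y d)
  ... | inj₁ x≤y⊔d = sameDir-ub x≤y⊔d (y≤x⊔y y d) (sameDir⇒⊔< sd)
  ... | inj₂ y⊔d≤x = sameDir-ub (≤-refl _) (≤-trans (y≤x⊔y y d) y⊔d≤x) x<m

  IsTop-cong : ∀ {P Q : N → Set} {t} → (∀ {z} → P z → Q z) → (∀ {z} → Q z → P z) →
               IsTop _≤_ P t → IsTop _≤_ Q t
  IsTop-cong P⇒Q Q⇒P (ub , least) =
    (λ z qz → ub z (Q⇒P qz)) , λ t′ ub′ → least t′ λ z pz → ub′ z (P⇒Q pz)

  top-unique : ∀ {P : N → Set} {t t′} → IsTop _≤_ P t → IsTop _≤_ P t′ → t ≡ t′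
  top-unique (ub , least) (ub′ , least′) = ≤-antisym (least _ ub′) (least′ _ ub)

  top-not-up-closed : ∀ {P : N → Set} {t x} → UpClosed _≤_ P → P x → ¬ IsTop _≤_ P t
  top-not-up-closed up px (ub , _) = <-irrefl (ub _ (up _ _ px (proj₁ (ub _ px))))

module _ {N : Set} (_≤_ : N → N → Set) (_∼_ : N → N → Set) (root : N) where

  data ClassDepth : N → ℕ → Set where
    onAxis   : ∀ {x} → root ∼ x → ClassDepth x zero
    belowTop : ∀ {x t n} → ¬ root ∼ x → IsTop _≤_ (x ∼_) t → ClassDepth t n →
               ClassDepth x (suc n)

record LineEquivalence (T : JoinTree) : Set₁ where
  open JoinTree T
  field
    _∼_           : N → N → Set
    ∼-refl        : ∀ x → x ∼ x
    ∼-sym         : ∀ {x y} → x ∼ y → y ∼ x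
    ∼-trans       : ∀ {x y z} → x ∼ y → y ∼ z → x ∼ z
    ∼-comparable  : ∀ {x y} → x ∼ y → (x ≤ y) ⊎ (y ≤ x)
    ∼-convex      : ∀ {x y z} → x ∼ z → x ≤ y → y ≤ z → x ∼ y
    root          : N
    root-up       : ∀ {y} → root ≤ y → root ∼ y
    top-exists    : ∀ {x} → ¬ root ∼ x → ∃ (IsTop _≤_ (x ∼_))
    top-injective : ∀ {x y t} → IsTop _≤_ (x ∼_) t → IsTop _≤_ (y ∼_) t → x ∼ y
    least-degree  : ∀ {m} → IsLeast _≤_ (root ∼_) m → DegAtMost1 _≤_ m
    depth         : ∀ x → ∃ (ClassDepth _≤_ _∼_ root x)

  axis-up : ∀ {x y} → root ∼ x → x ≤ y → root ∼ y
  axis-up {x} {y} r∼x x≤y with ∼-comparable r∼x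
  ... | inj₁ r≤x = root-up (≤-trans r≤x x≤y)
  ... | inj₂ x≤r with upLinear x root y x≤r x≤y
  ... | inj₁ r≤y = root-up r≤y
  ... | inj₂ y≤r = ∼-trans r∼x (∼-convex (∼-sym r∼x) x≤y y≤r)

module LineEquivalence⇒Structuring
  (em : ExcludedMiddle (lsuc 0ℓ)) (T : JoinTree) (E : LineEquivalence T) where

  open JoinTreeProperties T
  open LineEquivalence E
  open Classical em

  -- Each class is indexed by its element of least code.
  private
    least-in-class : ∀ x → Σ N λ r → x ∼ r × (∀ y → x ∼ y → code r ≤ℕ code y)
    least-in-class x = argmin code (x ∼_) (∼-refl x)

  canon : N → N
  canon x = proj₁ (least-in-class x)

  x∼canon : ∀ x → x ∼ canon x
  x∼canon x = proj₁ (proj₂ (least-in-class x))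

  canon-resp : ∀ {x y} → x ∼ y → canon x ≡ canon y
  canon-resp {x} {y} x∼y = code-injective (ℕ.≤-antisym
    (proj₂ (proj₂ (least-in-class x)) _ (∼-trans x∼y (x∼canon y)))
    (proj₂ (proj₂ (least-in-class y)) _ (∼-trans (∼-sym x∼y) (x∼canon x))))

  Class : Set
  Class = Σ N λ r → canon r ≡ r

  class : N → Class
  class x = canon x , sym (canon-resp (x∼canon x))

  Line : Class → N → Set
  Line (r , _) x = r ∼ x

  class-≡ : ∀ {r r′} (p : canon r ≡ r) (p′ : canon r′ ≡ r′) → r ∼ r′ →
            _≡_ {A = Class} (r , p) (r′ , p′)
  class-≡ {r} {r′} p p′ r∼r′ = lemma (trans (sym p) (trans (canon-resp r∼r′) p′)) p p′
    where
    lemma : ∀ {r r′} → r ≡ r′ → (p : canon r ≡ r) (p′ : canon r′ ≡ r′) →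
            _≡_ {A = Class} (r , p) (r′ , p′)
    lemma refl p p′ = cong (_ ,_) (uip p p′)

  axis : Class
  axis = class root

  Line-axis⇒∼ : ∀ {x} → Line axis x → root ∼ x
  Line-axis⇒∼ = ∼-trans (x∼canon root)

  ∼⇒Line-axis : ∀ {x} → root ∼ x → Line axis x
  ∼⇒Line-axis = ∼-trans (∼-sym (x∼canon root))

  ≢axis⇒≁root : ∀ {r p} → (r , p) ≢ axis → ¬ root ∼ r
  ≢axis⇒≁root {r} {p} ne root∼r =
    ne (class-≡ p (proj₂ axis) (∼-trans (∼-sym root∼r) (x∼canon root)))

  class-≡⇒∼ : ∀ {x y} → class x ≡ class y → x ∼ y
  class-≡⇒∼ {x} {y} e =
    ∼-trans (x∼canon x) (subst (_∼ y) (sym (cong proj₁ e)) (∼-sym (x∼canon y)))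

  classDepth⇒Depth : ∀ {x n} → ClassDepth _≤_ _∼_ root x n → Depth _≤_ Line axis x n
  classDepth⇒Depth (onAxis root∼x) = atAxis (∼⇒Line-axis root∼x)
  classDepth⇒Depth {x} (belowTop root≁x top d) =
    step {i = class x} (∼-sym (x∼canon x)) (λ e → root≁x (∼-sym (class-≡⇒∼ e)))
      (IsTop-cong (∼-trans (∼-sym (x∼canon x))) (∼-trans (x∼canon x)) top)
      (classDepth⇒Depth d)

  Depth⇒classDepth : ∀ {x n} → Depth _≤_ Line axis x n → ClassDepth _≤_ _∼_ root x n
  Depth⇒classDepth (atAxis l) = onAxis (Line-axis⇒∼ l)
  Depth⇒classDepth (step {i = r , p} r∼x ne top d) =
    belowTop (λ root∼x → ≢axis⇒≁root ne (∼-trans root∼x (∼-sym r∼x)))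
      (IsTop-cong (∼-trans (∼-sym r∼x)) (∼-trans r∼x) top)
      (Depth⇒classDepth d)

  structuring : Structuring T
  structuring = record
    { I           = Class
    ; U           = Line
    ; lines       = λ { (r , _) →
        (λ x y r∼x r∼y → ∼-comparable (∼-trans (∼-sym r∼x) r∼y)) ,
        (λ x y z r∼x r∼z x≤y y≤z → ∼-trans r∼x (∼-convex (∼-trans (∼-sym r∼x) r∼z) x≤y y≤z)) }
    ; nonempty    = λ { (r , _) → r , ∼-refl r }
    ; cover       = λ x → class x , ∼-sym (x∼canon x)
    ; disjoint    = λ { {_ , p} {_ , p′} r∼x r′∼x →
        class-≡ p p′ (∼-trans r∼x (∼-sym r′∼x)) }
    ; axis        = axis
    ; axisUp      = λ x y l x≤y → ∼⇒Line-axis (axis-up (Line-axis⇒∼ l) x≤y)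
    ; axisUnique  = axisUnique
    ; tops        = λ { (_ , _) ne → top-exists (≢axis⇒≁root ne) }
    ; finiteDepth = λ x → proj₁ (depth x) , classDepth⇒Depth (proj₂ (depth x))
    }
    where
    axisUnique : ∀ i → UpClosed _≤_ (Line i) → i ≡ axis
    axisUnique (r , p) up with dec (root ∼ r)
    ... | yes root∼r = class-≡ p (proj₂ axis) (∼-trans (∼-sym root∼r) (x∼canon root))
    ... | no root≁r = ⊥-elim (top-not-up-closed up (∼-refl r) (proj₂ (top-exists root≁r)))

  structuring-isSBJ : IsSBJ T structuring
  structuring-isSBJ = record
    { axisLeastDeg = λ m (l , least) →
        least-degree (Line-axis⇒∼ l , λ x root∼x → least x (∼⇒Line-axis root∼x))
    ; topOfOne     = λ { t (_ , p) (_ , p′) top top′ → class-≡ p p′ (top-injective top top′) }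
    }

module BJ⇒LineEquivalence (em : ExcludedMiddle (lsuc 0ℓ)) (T : JoinTree) (bj : IsBJ T) where

  open JoinTreeProperties T
  open Classical em

  ≤⇒≡⊎< : ∀ {x y} → x ≤ y → x ≡ y ⊎ x < y
  ≤⇒≡⊎< {x} {y} x≤y with dec (x ≡ y)
  ... | yes x≡y = inj₁ x≡y
  ... | no x≢y = inj₂ (x≤y , x≢y)

  LeastCodeBelow : N → N → Set
  LeastCodeBelow m d = d < m × (∀ w → w < m → code d ≤ℕ code w)

  leastCodeBelow : ∀ {w m} → w < m → ∃ (LeastCodeBelow m)
  leastCodeBelow {m = m} = argmin code (_< m)

  leastCodeBelow-unique : ∀ {m d e} → LeastCodeBelow m d → LeastCodeBelow m e → d ≡ e
  leastCodeBelow-unique (d<m , d-least) (e<m , e-least) =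
    code-injective (ℕ.≤-antisym (d-least _ e<m) (e-least _ d<m))

  record Break (y m : N) : Set where
    constructor break
    field
      below       : y < m
      guide       : N
      guide-least : LeastCodeBelow m guide
      diverges    : ¬ SameDir _≤_ m y guide

  open Break

  NoBreakUpTo : N → N → Set
  NoBreakUpTo y z = ∀ m → y < m → m ≤ z → ¬ Break y m

  Unbroken : N → Set
  Unbroken y = ∀ m → ¬ Break y m

  noBreak⇒sameDir : ∀ {y m d} → y < m → ¬ Break y m → LeastCodeBelow m d → SameDir _≤_ m y d
  noBreak⇒sameDir y<m no-break least = dne λ div → no-break (break y<m _ least div)

  break-transfer : ∀ {x y m} → (x ≤ y) ⊎ (y ≤ x) → x < m → y < m → Break x m → Break y m
  break-transfer (inj₁ x≤y) x<m y<m (break _ d least div) =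
    break y<m d least λ sd → div (sameDir-downward x≤y sd)
  break-transfer (inj₂ y≤x) x<m y<m (break _ d least div) =
    break y<m d least λ sd → div (sameDir-upward y≤x x<m sd)

  guide-code-< : ∀ {y m w e} (b : Break y m) → y ≤ w → e ≤ w → w < m →
                 code (guide b) <ℕ code e
  guide-code-< (break _ d (_ , d-least) div) y≤w e≤w w<m =
    ℕ.≤∧≢⇒< (d-least _ (≤-<-trans e≤w w<m))
            λ codes≡ → div (d≡e⇒sameDir (code-injective codes≡))
    where
    d≡e⇒sameDir : d ≡ _ → SameDir _≤_ _ _ d
    d≡e⇒sameDir refl = sameDir-ub y≤w e≤w w<m

  guide-code≤ : ∀ {y m} (b : Break y m) → code (guide b) ≤ℕ code y
  guide-code≤ b = proj₂ (guide-least b) _ (below b)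

  noBreak-refl : ∀ x → NoBreakUpTo x x
  noBreak-refl x m x<m m≤x _ = <⇒≱ x<m m≤x

  noBreak-shorten : ∀ {x y z} → NoBreakUpTo x z → y ≤ z → NoBreakUpTo x y
  noBreak-shorten no-break y≤z m x<m m≤y = no-break m x<m (≤-trans m≤y y≤z)

  noBreak-raise : ∀ {x y z} → x ≤ y → NoBreakUpTo x z → NoBreakUpTo y z
  noBreak-raise x≤y no-break m y<m m≤z b =
    no-break m x<m m≤z (break-transfer (inj₂ x≤y) y<m x<m b)
    where x<m = ≤-<-trans x≤y y<m

  noBreak-trans : ∀ {x y z} → x ≤ y → NoBreakUpTo x y → NoBreakUpTo y z → NoBreakUpTo x z
  noBreak-trans {x} {y} x≤y nb-xy nb-yz m x<m m≤z b with upLinear x m y (proj₁ x<m) x≤y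
  ... | inj₁ m≤y = nb-xy m x<m m≤y b
  ... | inj₂ y≤m with ≤⇒≡⊎< y≤m
  ... | inj₁ refl = nb-xy m x<m (≤-refl m) b
  ... | inj₂ y<m = nb-yz m y<m m≤z (break-transfer (inj₁ x≤y) x<m y<m b)

  leastCodeBelow⇒noBreak : ∀ {m d} → LeastCodeBelow m d → NoBreakUpTo d m
  leastCodeBelow⇒noBreak (_ , d-least) b d<b b≤m br =
    ℕ.<⇒≱ (guide-code-< br (≤-refl _) (≤-refl _) d<b)
      (d-least _ (<-≤-trans (proj₁ (guide-least br)) b≤m))

  -- If x and z lie below y without breaking, they lie in the guide's
  -- direction at x ⊔ z, so they cannot be incomparable.
  noBreak-comparable : ∀ {x y z} → x ≤ y → z ≤ y → NoBreakUpTo x y → NoBreakUpTo z y →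
                       (x ≤ z) ⊎ (z ≤ x)
  noBreak-comparable {x} {y} {z} x≤y z≤y nb-x nb-z with dec (x ≤ z) | dec (z ≤ x)
  ... | yes x≤z | _ = inj₁ x≤z
  ... | no _ | yes z≤x = inj₂ z≤x
  ... | no x≰z | no z≰x = ⊥-elim (<-irrefl (sameDir⇒⊔< (sameDir-trans sd-x (sameDir-sym sd-z))))
    where
    j≤y = ⊔-least x≤y z≤y
    x<j : x < (x ⊔ z)
    x<j = x≤x⊔y x z , λ x≡j → z≰x (subst (z ≤_) (sym x≡j) (y≤x⊔y x z))
    z<j : z < (x ⊔ z)
    z<j = y≤x⊔y x z , λ z≡j → x≰z (subst (x ≤_) (sym z≡j) (x≤x⊔y x z))
    guide-j = proj₂ (leastCodeBelow x<j)
    sd-x = noBreak⇒sameDir x<j (nb-x _ x<j j≤y) guide-j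
    sd-z = noBreak⇒sameDir z<j (nb-z _ z<j j≤y) guide-j

  infix 4 _∼_
  _∼_ : N → N → Set
  x ∼ y = (x ≤ y × NoBreakUpTo x y) ⊎ (y ≤ x × NoBreakUpTo y x)

  ∼-refl : ∀ x → x ∼ x
  ∼-refl x = inj₁ (≤-refl x , noBreak-refl x)

  ∼-sym : ∀ {x y} → x ∼ y → y ∼ x
  ∼-sym (inj₁ p) = inj₂ p
  ∼-sym (inj₂ p) = inj₁ p

  ∼-comparable : ∀ {x y} → x ∼ y → (x ≤ y) ⊎ (y ≤ x)
  ∼-comparable (inj₁ (x≤y , _)) = inj₁ x≤y
  ∼-comparable (inj₂ (y≤x , _)) = inj₂ y≤x

  ∼-trans : ∀ {x y z} → x ∼ y → y ∼ z → x ∼ z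
  ∼-trans (inj₁ (x≤y , nb-xy)) (inj₁ (y≤z , nb-yz)) =
    inj₁ (≤-trans x≤y y≤z , noBreak-trans x≤y nb-xy nb-yz)
  ∼-trans (inj₁ (x≤y , nb-xy)) (inj₂ (z≤y , nb-zy)) with noBreak-comparable x≤y z≤y nb-xy nb-zy
  ... | inj₁ x≤z = inj₁ (x≤z , noBreak-shorten nb-xy z≤y)
  ... | inj₂ z≤x = inj₂ (z≤x , noBreak-shorten nb-zy x≤y)
  ∼-trans {x} {y} {z} (inj₂ (y≤x , nb-yx)) (inj₁ (y≤z , nb-yz)) with upLinear y x z y≤x y≤z
  ... | inj₁ x≤z = inj₁ (x≤z , noBreak-raise y≤x nb-yz)
  ... | inj₂ z≤x = inj₂ (z≤x , noBreak-raise y≤z nb-yx)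
  ∼-trans (inj₂ (y≤x , nb-yx)) (inj₂ (z≤y , nb-zy)) =
    inj₂ (≤-trans z≤y y≤x , noBreak-trans z≤y nb-zy nb-yx)

  ∼-convex : ∀ {x y z} → x ∼ z → x ≤ y → y ≤ z → x ∼ y
  ∼-convex (inj₁ (_ , nb-xz)) x≤y y≤z = inj₁ (x≤y , noBreak-shorten nb-xz y≤z)
  ∼-convex (inj₂ (z≤x , nb-zx)) x≤y y≤z =
    inj₂ (≤-trans y≤z z≤x , noBreak-raise (≤-trans z≤x x≤y) (noBreak-shorten nb-zx (≤-refl _)))

  unbroken-∼ : ∀ {x y} → Unbroken x → Unbroken y → x ∼ y
  unbroken-∼ {x} {y} ux uy =
    ∼-trans (inj₁ (x≤x⊔y x y , λ m _ _ → ux m)) (inj₂ (y≤x⊔y x y , λ m _ _ → uy m))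

  unbroken-resp-∼ : ∀ {x y} → x ∼ y → Unbroken x → Unbroken y
  unbroken-resp-∼ (inj₁ (x≤y , _)) ux m b =
    ux m (break-transfer (inj₂ x≤y) (below b) (≤-<-trans x≤y (below b)) b)
  unbroken-resp-∼ {x} {y} (inj₂ (y≤x , nb-yx)) ux m b with upLinear y x m y≤x (proj₁ (below b))
  ... | inj₂ m≤x = nb-yx m (below b) m≤x b
  ... | inj₁ x≤m with ≤⇒≡⊎< x≤m
  ... | inj₁ refl = nb-yx m (below b) (≤-refl m) b
  ... | inj₂ x<m = ux m (break-transfer (inj₁ y≤x) (below b) x<m b)

  LeastBreak : N → N → Set
  LeastBreak y t = Break y t × (∀ m → Break y m → t ≤ m)

  -- The guides of the breaks of y have strictly decreasing codes as the break
  -- moves up, so the break maximising the guide's code is the least one.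
  leastBreak : ∀ {y m} → Break y m → ∃ (LeastBreak y)
  leastBreak {y} {m} b with argmin (λ (m , b) → code y ∸ code (guide b)) (λ _ → ⊤) {m , b} tt
  ... | (t , bt) , _ , minimal = t , bt , t-least
    where
    t-least : ∀ m → Break y m → t ≤ m
    t-least m bm with upLinear y t m (proj₁ (below bt)) (proj₁ (below bm))
    ... | inj₁ t≤m = t≤m
    ... | inj₂ m≤t with ≤⇒≡⊎< m≤t
    ... | inj₁ refl = ≤-refl m
    ... | inj₂ m<t = ⊥-elim (ℕ.<⇒≱
          (ℕ.∸-monoʳ-< (guide-code-< bt (proj₁ (below bm)) (proj₁ (proj₁ (guide-least bm))) m<t)
                       (guide-code≤ bm))
          (minimal (m , bm) tt))

  broken⇒leastBreak : ∀ {y} → ¬ Unbroken y → ∃ (LeastBreak y)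
  broken⇒leastBreak broken = leastBreak (proj₂ (dne λ no-break → broken λ m b → no-break (m , b)))

  noBreak-below-leastBreak : ∀ {y t w} → (∀ m → Break y m → t ≤ m) → w < t → NoBreakUpTo y w
  noBreak-below-leastBreak t-least w<t m _ m≤w b = <⇒≱ w<t (≤-trans (t-least m b) m≤w)

  leastBreak⇒top : ∀ {y t} → LeastBreak y t → IsTop _≤_ (y ∼_) t
  leastBreak⇒top {y} {t} (bt , t-least) = ub , least
    where
    y<t = below bt
    ub : StrictUB _≤_ (y ∼_) t
    ub z (inj₂ (z≤y , _)) = ≤-<-trans z≤y y<t
    ub z (inj₁ (y≤z , nb-yz)) with upLinear y z t y≤z (proj₁ y<t)
    ... | inj₂ t≤z = ⊥-elim (nb-yz t y<t t≤z bt)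
    ... | inj₁ z≤t = z≤t , λ { refl → nb-yz t y<t (≤-refl t) bt }
    least : ∀ t′ → StrictUB _≤_ (y ∼_) t′ → t ≤ t′
    least t′ ub′ with dec (t ≤ t′)
    ... | yes t≤t′ = t≤t′
    ... | no t≰t′ = ⊥-elim (<-irrefl (ub′ t′ (inj₁ (proj₁ y<t′ , nb))))
      where
      y<t′ = ub′ y (∼-refl y)
      nb : NoBreakUpTo y t′
      nb m _ m≤t′ bm = t≰t′ (≤-trans (t-least m bm) m≤t′)

  unbroken⇒noTop : ∀ {y t} → Unbroken y → ¬ IsTop _≤_ (y ∼_) t
  unbroken⇒noTop uy (ub , _) = <-irrefl (ub _ (inj₁ (proj₁ (ub _ (∼-refl _)) , λ m _ _ → uy m)))

  top⇒leastBreak : ∀ {y t} → IsTop _≤_ (y ∼_) t → LeastBreak y t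
  top⇒leastBreak {y} {t} top with dec (Unbroken y)
  ... | yes uy = ⊥-elim (unbroken⇒noTop uy top)
  ... | no broken with broken⇒leastBreak broken
  ... | t′ , lb = subst (LeastBreak y) (top-unique (leastBreak⇒top lb) top) lb

  top-injective : ∀ {x y t} → IsTop _≤_ (x ∼_) t → IsTop _≤_ (y ∼_) t → x ∼ y
  top-injective {x} {y} {t} top-x top-y with top⇒leastBreak top-x | top⇒leastBreak top-y
  ... | break x<t d guide-d div-x , x-least | break y<t e guide-e div-y , y-least
      with leastCodeBelow-unique guide-d guide-e
  ... | refl with dec (SameDir _≤_ t x y)
  ... | yes sd = ∼-trans (inj₁ (x≤x⊔y x y , noBreak-below-leastBreak x-least (sameDir⇒⊔< sd)))
                         (inj₂ (y≤x⊔y x y , noBreak-below-leastBreak y-least (sameDir⇒⊔< sd)))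
  ... | no ¬sd = ⊥-elim (bj t (x , y , d , x<t , y<t , proj₁ guide-d , ¬sd , div-x , div-y))

  CodesBelow : ℕ → N → Set
  CodesBelow k x = ∀ {m} (b : Break x m) → code (guide b) <ℕ k

  codesBelow-init : ∀ x → CodesBelow (suc (code x)) x
  codesBelow-init x b = s≤s (guide-code≤ b)

  codesBelow-zero : ∀ {x} → CodesBelow zero x → Unbroken x
  codesBelow-zero bound m b = ℕ.n≮0 (bound b)

  codesBelow-top : ∀ {k x t} → LeastBreak x t → CodesBelow (suc k) x → CodesBelow k t
  codesBelow-top (bt , _) bound b =
    ℕ.<-≤-trans (guide-code-< b (≤-refl _) (proj₁ (proj₁ (guide-least bt))) (below b))
                (ℕ.≤-pred (bound bt))

  unbroken-exists : ∃ Unbroken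
  unbroken-exists = climb (suc (code inhabited)) inhabited (codesBelow-init inhabited)
    where
    climb : ∀ k x → CodesBelow k x → ∃ Unbroken
    climb zero x bound = x , codesBelow-zero bound
    climb (suc k) x bound with dec (Unbroken x)
    ... | yes ux = x , ux
    ... | no broken = let t , lb = broken⇒leastBreak broken in climb k t (codesBelow-top lb bound)

  root : N
  root = proj₁ unbroken-exists

  root-unbroken : Unbroken root
  root-unbroken = proj₂ unbroken-exists

  depth : ∀ x → ∃ (ClassDepth _≤_ _∼_ root x)
  depth x = climb (suc (code x)) x (codesBelow-init x)
    where
    climb : ∀ k x → CodesBelow k x → ∃ (ClassDepth _≤_ _∼_ root x)
    climb zero x bound = zero , onAxis (unbroken-∼ root-unbroken (codesBelow-zero bound))
    climb (suc k) x bound with dec (Unbroken x)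
    ... | yes ux = zero , onAxis (unbroken-∼ root-unbroken ux)
    ... | no broken =
          let t , lb = broken⇒leastBreak broken
              n , d = climb k t (codesBelow-top lb bound)
          in suc n , belowTop (λ root∼x → broken (unbroken-resp-∼ root∼x root-unbroken))
                              (leastBreak⇒top lb) d

  -- The least node of the axis has nothing below it: its guide would lie on the axis.
  least-degree : ∀ {m} → IsLeast _≤_ (root ∼_) m → DegAtMost1 _≤_ m
  least-degree (root∼m , m-least) (z , _ , z<m , _) =
    let d , guide-d = leastCodeBelow z<m
        d<m = proj₁ guide-d
    in <⇒≱ d<m (m-least d (∼-trans root∼m (inj₂ (proj₁ d<m , leastCodeBelow⇒noBreak guide-d))))

  lineEquivalence : LineEquivalence T
  lineEquivalence = record
    { _∼_           = _∼_
    ; ∼-refl        = ∼-refl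
    ; ∼-sym         = ∼-sym
    ; ∼-trans       = ∼-trans
    ; ∼-comparable  = ∼-comparable
    ; ∼-convex      = ∼-convex
    ; root          = root
    ; root-up       = λ root≤y → inj₁ (root≤y , λ m _ _ → root-unbroken m)
    ; top-exists    = top-exists
    ; top-injective = top-injective
    ; least-degree  = least-degree
    ; depth         = depth
    }
    where
    top-exists : ∀ {x} → ¬ root ∼ x → ∃ (IsTop _≤_ (x ∼_))
    top-exists {x} root≁x with dec (Unbroken x)
    ... | yes ux = ⊥-elim (root≁x (unbroken-∼ root-unbroken ux))
    ... | no broken = let t , lb = broken⇒leastBreak broken in t , leastBreak⇒top lb

BJ⇒SBJ : ExcludedMiddle (lsuc 0ℓ) → (T : JoinTree) → IsBJ T → Σ (Structuring T) (IsSBJ T)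
BJ⇒SBJ em T bj = structuring , structuring-isSBJ
  where open LineEquivalence⇒Structuring em T (BJ⇒LineEquivalence.lineEquivalence em T bj)

private
  variable
    n m : ℕ

v₀ : Fin (suc n)
v₀ = fzero

v₁ : Fin (suc (suc n))
v₁ = fsuc v₀

v₂ : Fin (suc (suc (suc n)))
v₂ = fsuc v₁

infixr 6 _∧_
infixr 5 _⇒_
infix 7 _<ᶠ_

_∧_ : Form n m → Form n m → Form n m
_∧_ = _∧ᶠ_

_⇒_ : Form n m → Form n m → Form n m
_⇒_ = _⇒ᶠ_

_<ᶠ_ : Fin n → Fin n → Form n m
i <ᶠ j = (i ≼ j) ∧ ¬ᶠ (i ≐ j)

sameColourᶠ : Fin n → Fin n → Form n m
sameColourᶠ i j = (inN₀ i ⇒ inN₀ j) ∧ (inN₀ j ⇒ inN₀ i)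

monochromeᶠ : Fin n → Fin n → Form n m
monochromeᶠ i j = ∀¹ ((fsuc i ≼ v₀) ∧ (v₀ ≼ fsuc j) ⇒ sameColourᶠ v₀ (fsuc i))

sameLineᶠ : Fin n → Fin n → Form n m
sameLineᶠ i j = ((i ≼ j) ∧ monochromeᶠ i j) ∨ᶠ ((j ≼ i) ∧ monochromeᶠ j i)

onAxisᶠ : Fin n → Form n m
onAxisᶠ i = ∀¹ ((fsuc i ≼ v₀) ⇒ sameLineᶠ (fsuc i) v₀)

aboveLineᶠ : Fin n → Fin n → Form n m
aboveLineᶠ i t = ∀¹ (sameLineᶠ (fsuc i) v₀ ⇒ v₀ <ᶠ fsuc t)

topᶠ : Fin n → Fin n → Form n m
topᶠ i t = aboveLineᶠ i t ∧ ∀¹ (aboveLineᶠ (fsuc i) v₀ ⇒ (fsuc t ≼ v₀))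

joinᶠ : Fin n → Fin n → Fin n → Form n m
joinᶠ x y j =
  (x ≼ j) ∧ (y ≼ j) ∧ ∀¹ ((fsuc x ≼ v₀) ⇒ (fsuc y ≼ v₀) ⇒ (fsuc j ≼ v₀))

sameDirᶠ : Fin n → Fin n → Fin n → Form n m
sameDirᶠ x a b = ∃¹ (joinᶠ (fsuc a) (fsuc b) v₀ ∧ v₀ <ᶠ fsuc x)

degAtMost2ᶠ : Fin n → Form n m
degAtMost2ᶠ x = ¬ᶠ ∃¹ (∃¹ (∃¹ (v₂ <ᶠ x′ ∧ v₁ <ᶠ x′ ∧ v₀ <ᶠ x′ ∧
    ¬ᶠ sameDirᶠ x′ v₂ v₁ ∧ ¬ᶠ sameDirᶠ x′ v₂ v₀ ∧ ¬ᶠ sameDirᶠ x′ v₁ v₀)))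
  where x′ = fsuc (fsuc (fsuc x))

degAtMost1ᶠ : Fin n → Form n m
degAtMost1ᶠ x = ¬ᶠ ∃¹ (∃¹ (v₁ <ᶠ x′ ∧ v₀ <ᶠ x′ ∧ ¬ᶠ sameDirᶠ x′ v₁ v₀))
  where x′ = fsuc (fsuc x)

sbjSentence : Sentence
sbjSentence =
  ∀¹ (v₀ ≼ v₀) ∧
  ∀¹ (∀¹ (∀¹ ((v₂ ≼ v₁) ⇒ (v₁ ≼ v₀) ⇒ (v₂ ≼ v₀)))) ∧
  ∀¹ (∀¹ ((v₁ ≼ v₀) ⇒ (v₀ ≼ v₁) ⇒ (v₁ ≐ v₀))) ∧
  ∀¹ (∀¹ (∀¹ ((v₂ ≼ v₁) ⇒ (v₂ ≼ v₀) ⇒ ((v₁ ≼ v₀) ∨ᶠ (v₀ ≼ v₁))))) ∧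
  ∀¹ (∀¹ (∃¹ (joinᶠ v₂ v₁ v₀))) ∧
  ∀¹ (degAtMost2ᶠ v₀) ∧
  ∃¹ (v₀ ≐ v₀) ∧
  ∀¹ ((inN₁ v₀ ⇒ ¬ᶠ inN₀ v₀) ∧ (¬ᶠ inN₀ v₀ ⇒ inN₁ v₀)) ∧
  ∀¹ (∀¹ (∀¹ (sameLineᶠ v₂ v₁ ⇒ sameLineᶠ v₁ v₀ ⇒ sameLineᶠ v₂ v₀))) ∧
  ∃¹ (onAxisᶠ v₀ ∧ inN₀ v₀) ∧
  ∀¹ (¬ᶠ onAxisᶠ v₀ ⇒ ∃¹ (topᶠ v₁ v₀)) ∧
  ∀¹ (∀¹ (∀¹ (topᶠ v₁ v₂ ⇒ topᶠ v₀ v₂ ⇒ sameLineᶠ v₁ v₀))) ∧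
  ∀¹ (onAxisᶠ v₀ ∧ ∀¹ (sameLineᶠ v₁ v₀ ⇒ (v₁ ≼ v₀)) ⇒ degAtMost1ᶠ v₀) ∧
  ∀¹ (∀¹ (topᶠ v₁ v₀ ⇒ ¬ᶠ sameColourᶠ v₁ v₀)) ∧
  ∀¹ (∀² ((v₀ ∈ˢ v₀) ∧
          ∀¹ (∀¹ ((v₁ ∈ˢ v₀) ∧ ¬ᶠ onAxisᶠ v₁ ∧ topᶠ v₁ v₀ ⇒ (v₀ ∈ˢ v₀))) ⇒
          ∃¹ ((v₀ ∈ˢ v₀) ∧ onAxisᶠ v₀)))

module MSSemantics (M : Str) where

  open Str M
  open Equivalence using (to; from)

  SameColour : C → C → Set
  SameColour a b = (P₀ a → P₀ b) × (P₀ b → P₀ a)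

  Monochrome : C → C → Set
  Monochrome a b = ∀ w → R a w → R w b → SameColour w a

  SameLine : C → C → Set
  SameLine a b = (R a b × Monochrome a b) ⊎ (R b a × Monochrome b a)

  OnAxis : C → Set
  OnAxis a = ∀ b → R a b → SameLine a b

  Env : ℕ → Set
  Env n = Fin n → C

  SetEnv : ℕ → Set₁
  SetEnv m = Fin m → C → Set

  ε : Env 0
  ε ()

  ∅ : SetEnv 0
  ∅ ()

  infixl 5 _▸_
  _▸_ : Env n → C → Env (suc n)
  _▸_ = extend₀

  sat-< : ∀ (ρ : Env n) (σ : SetEnv m) i j →
          Sat M (i <ᶠ j) ρ σ ⇔ Lt R (ρ i) (ρ j)
  sat-< ρ σ i j = mk⇔ (λ (lift i≤j , i≢j) → i≤j , λ e → i≢j (lift e))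
                      (λ (i≤j , i≢j) → lift i≤j , λ e → i≢j (lower e))

  sat-sameColour : ∀ (ρ : Env n) (σ : SetEnv m) i j →
                   Sat M (sameColourᶠ i j) ρ σ ⇔ SameColour (ρ i) (ρ j)
  sat-sameColour ρ σ i j =
    mk⇔ (λ (f , g) → (λ p → lower (f (lift p))) , (λ p → lower (g (lift p))))
        (λ (f , g) → (λ p → lift (f (lower p))) , (λ p → lift (g (lower p))))

  sat-monochrome : ∀ (ρ : Env n) (σ : SetEnv m) i j →
                   Sat M (monochromeᶠ i j) ρ σ ⇔ Monochrome (ρ i) (ρ j)
  sat-monochrome ρ σ i j =
    mk⇔ (λ h w i≤w w≤j → to (colour w) (h w (lift i≤w , lift w≤j)))
        (λ h w (lift i≤w , lift w≤j) → from (colour w) (h w i≤w w≤j))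
    where colour = λ w → sat-sameColour (ρ ▸ w) σ v₀ (fsuc i)

  sat-sameLine : ∀ (ρ : Env n) (σ : SetEnv m) i j →
                 Sat M (sameLineᶠ i j) ρ σ ⇔ SameLine (ρ i) (ρ j)
  sat-sameLine ρ σ i j = mk⇔
    (λ { (inj₁ (lift i≤j , h)) → inj₁ (i≤j , to (sat-monochrome ρ σ i j) h)
       ; (inj₂ (lift j≤i , h)) → inj₂ (j≤i , to (sat-monochrome ρ σ j i) h) })
    (λ { (inj₁ (i≤j , h)) → inj₁ (lift i≤j , from (sat-monochrome ρ σ i j) h)
       ; (inj₂ (j≤i , h)) → inj₂ (lift j≤i , from (sat-monochrome ρ σ j i) h) })

  sat-onAxis : ∀ (ρ : Env n) (σ : SetEnv m) i →
               Sat M (onAxisᶠ i) ρ σ ⇔ OnAxis (ρ i)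
  sat-onAxis ρ σ i =
    mk⇔ (λ h b i≤b → to (line b) (h b (lift i≤b)))
        (λ h b (lift i≤b) → from (line b) (h b i≤b))
    where line = λ b → sat-sameLine (ρ ▸ b) σ (fsuc i) v₀

  sat-aboveLine : ∀ (ρ : Env n) (σ : SetEnv m) i t →
                  Sat M (aboveLineᶠ i t) ρ σ ⇔ StrictUB R (SameLine (ρ i)) (ρ t)
  sat-aboveLine ρ σ i t =
    mk⇔ (λ h w l → to (below w) (h w (from (line w) l)))
        (λ h w l → from (below w) (h w (to (line w) l)))
    where
    line  = λ w → sat-sameLine (ρ ▸ w) σ (fsuc i) v₀
    below = λ w → sat-< (ρ ▸ w) σ v₀ (fsuc t)

  sat-top : ∀ (ρ : Env n) (σ : SetEnv m) i t →
            Sat M (topᶠ i t) ρ σ ⇔ IsTop R (SameLine (ρ i)) (ρ t)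
  sat-top ρ σ i t = mk⇔
    (λ (ub , least) → to (sat-aboveLine ρ σ i t) ub ,
       λ t′ ub′ → lower (least t′ (from (above t′) ub′)))
    (λ (ub , least) → from (sat-aboveLine ρ σ i t) ub ,
       λ t′ ub′ → lift (least t′ (to (above t′) ub′)))
    where above = λ t′ → sat-aboveLine (ρ ▸ t′) σ (fsuc i) v₀

  sat-join : ∀ (ρ : Env n) (σ : SetEnv m) x y j →
             Sat M (joinᶠ x y j) ρ σ ⇔ IsJoin R (ρ x) (ρ y) (ρ j)
  sat-join ρ σ x y j = mk⇔
    (λ (lift x≤j , lift y≤j , least) →
       x≤j , y≤j , λ w x≤w y≤w → lower (least w (lift x≤w) (lift y≤w)))
    (λ (x≤j , y≤j , least) →
       lift x≤j , lift y≤j , λ w x≤w y≤w → lift (least w (lower x≤w) (lower y≤w)))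

  sat-sameDir : ∀ (ρ : Env n) (σ : SetEnv m) x a b →
                Sat M (sameDirᶠ x a b) ρ σ ⇔ SameDir R (ρ x) (ρ a) (ρ b)
  sat-sameDir ρ σ x a b = mk⇔
    (λ (j , isJoin , j<x) → j , to (join j) isJoin , to (below j) j<x)
    (λ (j , isJoin , j<x) → j , from (join j) isJoin , from (below j) j<x)
    where
    join  = λ j → sat-join (ρ ▸ j) σ (fsuc a) (fsuc b) v₀
    below = λ j → sat-< (ρ ▸ j) σ v₀ (fsuc x)

  sat-degAtMost2 : ∀ (ρ : Env n) (σ : SetEnv m) x →
                   Sat M (degAtMost2ᶠ x) ρ σ ⇔ DegAtMost2 R (ρ x)
  sat-degAtMost2 ρ σ x = mk⇔
    (λ h (a , b , c , a<x , b<x , c<x , ab , ac , bc) →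
       h (a , b , c , from (lt a b c v₂) a<x , from (lt a b c v₁) b<x , from (lt a b c v₀) c<x ,
          (λ s → ab (to (sd a b c v₂ v₁) s)) , (λ s → ac (to (sd a b c v₂ v₀) s)) ,
          (λ s → bc (to (sd a b c v₁ v₀) s))))
    (λ h (a , b , c , a<x , b<x , c<x , ab , ac , bc) →
       h (a , b , c , to (lt a b c v₂) a<x , to (lt a b c v₁) b<x , to (lt a b c v₀) c<x ,
          (λ s → ab (from (sd a b c v₂ v₁) s)) , (λ s → ac (from (sd a b c v₂ v₀) s)) ,
          (λ s → bc (from (sd a b c v₁ v₀) s))))
    where
    x′ = fsuc (fsuc (fsuc x))
    lt = λ a b c i → sat-< (ρ ▸ a ▸ b ▸ c) σ i x′
    sd = λ a b c i j → sat-sameDir (ρ ▸ a ▸ b ▸ c) σ x′ i j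

  sat-degAtMost1 : ∀ (ρ : Env n) (σ : SetEnv m) x →
                   Sat M (degAtMost1ᶠ x) ρ σ ⇔ DegAtMost1 R (ρ x)
  sat-degAtMost1 ρ σ x = mk⇔
    (λ h (a , b , a<x , b<x , ab) →
       h (a , b , from (lt a b v₁) a<x , from (lt a b v₀) b<x , λ s → ab (to (sd a b) s)))
    (λ h (a , b , a<x , b<x , ab) →
       h (a , b , to (lt a b v₁) a<x , to (lt a b v₀) b<x , λ s → ab (from (sd a b) s)))
    where
    x′ = fsuc (fsuc x)
    lt = λ a b i → sat-< (ρ ▸ a ▸ b) σ i x′
    sd = λ a b → sat-sameDir (ρ ▸ a ▸ b) σ x′ v₁ v₀

-- The meaning of the conjuncts of sbjSentence, in order.
record SBJAxioms (M : Str) : Set₁ where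
  open Str M
  open MSSemantics M
  field
    ≤-refl         : ∀ x → R x x
    ≤-trans        : ∀ {x y z} → R x y → R y z → R x z
    ≤-antisym      : ∀ {x y} → R x y → R y x → x ≡ y
    upLinear       : ∀ x y z → R x y → R x z → (R y z) ⊎ (R z y)
    joins          : ∀ x y → ∃ (IsJoin R x y)
    degAtMost2     : ∀ x → DegAtMost2 R x
    inhabited      : C
    P₁⇔¬P₀         : ∀ x → P₁ x ⇔ (¬ P₀ x)
    sameLine-trans : ∀ {x y z} → SameLine x y → SameLine y z → SameLine x z
    coloured-axis  : ∃ λ x → OnAxis x × P₀ x
    top-exists     : ∀ {x} → ¬ OnAxis x → ∃ (IsTop R (SameLine x))
    top-injective  : ∀ {x y t} → IsTop R (SameLine x) t → IsTop R (SameLine y) t → SameLine x y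
    least-degree   : ∀ {m} → OnAxis m → (∀ y → SameLine m y → R m y) → DegAtMost1 R m
    top-recoloured : ∀ {x t} → IsTop R (SameLine x) t → ¬ SameColour x t
    axis-reachable : ∀ x (X : C → Set) → X x →
                     (∀ {y t} → X y → ¬ OnAxis y → IsTop R (SameLine y) t → X t) →
                     ∃ λ y → X y × OnAxis y

module _ (M : Str) where

  open Str M
  open MSSemantics M
  open Equivalence using (to; from)

  models⇒axioms : Models M sbjSentence → SBJAxioms M
  models⇒axioms (refl′ , trans′ , antisym′ , linear′ , joins′ , deg2′ , inhabited′ , colours′ ,
                 sameLine-trans′ , axis′ , top-exists′ , top-injective′ , least-degree′ ,
                 recoloured′ , reachable′) = record
    { ≤-refl         = λ x → lower (refl′ x)
    ; ≤-trans        = λ p q → lower (trans′ _ _ _ (lift p) (lift q))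
    ; ≤-antisym      = λ p q → lower (antisym′ _ _ (lift p) (lift q))
    ; upLinear       = λ x y z p q → Sum.map lower lower (linear′ x y z (lift p) (lift q))
    ; joins          = λ x y →
        let j , h = joins′ x y in j , to (sat-join (ε ▸ x ▸ y ▸ j) ∅ v₂ v₁ v₀) h
    ; degAtMost2     = λ x → to (sat-degAtMost2 (ε ▸ x) ∅ v₀) (deg2′ x)
    ; inhabited      = proj₁ inhabited′
    ; P₁⇔¬P₀         = λ x → let f , g = colours′ x in
        mk⇔ (λ p q → f (lift p) (lift q)) (λ ¬p → lower (g λ q → ¬p (lower q)))
    ; sameLine-trans = λ {x} {y} {z} p q → let line = sat-sameLine (ε ▸ x ▸ y ▸ z) ∅ in
        to (line v₂ v₀) (sameLine-trans′ x y z (from (line v₂ v₁) p) (from (line v₁ v₀) q))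
    ; coloured-axis  = let x , ax , p = axis′ in x , to (sat-onAxis (ε ▸ x) ∅ v₀) ax , lower p
    ; top-exists     = λ {x} ¬ax →
        let t , top = top-exists′ x λ ax → ¬ax (to (sat-onAxis (ε ▸ x) ∅ v₀) ax)
        in t , to (sat-top (ε ▸ x ▸ t) ∅ v₁ v₀) top
    ; top-injective  = λ {x} {y} {t} top-x top-y → let ρ = ε ▸ t ▸ x ▸ y in
        to (sat-sameLine ρ ∅ v₁ v₀)
           (top-injective′ t x y (from (sat-top ρ ∅ v₁ v₂) top-x)
                                 (from (sat-top ρ ∅ v₀ v₂) top-y))
    ; least-degree   = λ {m} ax least → to (sat-degAtMost1 (ε ▸ m) ∅ v₀)
        (least-degree′ m (from (sat-onAxis (ε ▸ m) ∅ v₀) ax ,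
                          λ y l → lift (least y (to (sat-sameLine (ε ▸ m ▸ y) ∅ v₁ v₀) l))))
    ; top-recoloured = λ {x} {t} top same → let ρ = ε ▸ x ▸ t in
        recoloured′ x t (from (sat-top ρ ∅ v₁ v₀) top) (from (sat-sameColour ρ ∅ v₁ v₀) same)
    ; axis-reachable = λ x X Xx closed →
        let σ = extend ∅ X
            y , lift Xy , ax = reachable′ x X (lift Xx , λ y t (lift Xy , ¬ax , top) →
              let ρ = ε ▸ x ▸ y ▸ t in
              lift (closed Xy (λ ax → ¬ax (from (sat-onAxis ρ σ v₁) ax))
                              (to (sat-top ρ σ v₁ v₀) top)))
        in y , Xy , to (sat-onAxis (ε ▸ x ▸ y) σ v₀) ax
    }

  axioms⇒models : SBJAxioms M → Models M sbjSentence
  axioms⇒models A =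
    (λ x → lift (≤-refl x)) ,
    (λ x y z (lift p) (lift q) → lift (≤-trans p q)) ,
    (λ x y (lift p) (lift q) → lift (≤-antisym p q)) ,
    (λ x y z (lift p) (lift q) → Sum.map lift lift (upLinear x y z p q)) ,
    (λ x y → let j , join = joins x y in
       j , from (sat-join (ε ▸ x ▸ y ▸ j) ∅ v₂ v₁ v₀) join) ,
    (λ x → from (sat-degAtMost2 (ε ▸ x) ∅ v₀) (degAtMost2 x)) ,
    (inhabited , lift refl) ,
    (λ x → (λ (lift p) (lift q) → to (P₁⇔¬P₀ x) p q) ,
           (λ ¬p → lift (from (P₁⇔¬P₀ x) λ q → ¬p (lift q)))) ,
    (λ x y z p q → let line = sat-sameLine (ε ▸ x ▸ y ▸ z) ∅ in
       from (line v₂ v₀) (sameLine-trans (to (line v₂ v₁) p) (to (line v₁ v₀) q))) ,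
    (let x , ax , p = coloured-axis in x , from (sat-onAxis (ε ▸ x) ∅ v₀) ax , lift p) ,
    (λ x ¬ax → let t , top = top-exists λ ax → ¬ax (from (sat-onAxis (ε ▸ x) ∅ v₀) ax)
               in t , from (sat-top (ε ▸ x ▸ t) ∅ v₁ v₀) top) ,
    (λ t x y top-x top-y → let ρ = ε ▸ t ▸ x ▸ y in
       from (sat-sameLine ρ ∅ v₁ v₀)
            (top-injective (to (sat-top ρ ∅ v₁ v₂) top-x) (to (sat-top ρ ∅ v₀ v₂) top-y))) ,
    (λ m (ax , least) → from (sat-degAtMost1 (ε ▸ m) ∅ v₀)
       (least-degree (to (sat-onAxis (ε ▸ m) ∅ v₀) ax)
                     λ y l → lower (least y (from (sat-sameLine (ε ▸ m ▸ y) ∅ v₁ v₀) l)))) ,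
    (λ x t top same → let ρ = ε ▸ x ▸ t in
       top-recoloured (to (sat-top ρ ∅ v₁ v₀) top) (to (sat-sameColour ρ ∅ v₁ v₀) same)) ,
    (λ x X (lift Xx , closed) →
       let σ = extend ∅ X
           y , Xy , ax = axis-reachable x X Xx λ {y} {t} Xy ¬ax top → let ρ = ε ▸ x ▸ y ▸ t in
             lower (closed y t (lift Xy , (λ ax → ¬ax (to (sat-onAxis ρ σ v₁) ax)) ,
                                from (sat-top ρ σ v₁ v₀) top))
       in y , lift Xy , from (sat-onAxis (ε ▸ x ▸ y) σ v₀) ax)
    where open SBJAxioms A

module IsomorphismInvariance {A B : Str} (iso : A ≅ B) where

  private
    module A = Str A
    module B = Str B

  open _≅_ iso
  open Inverse bij using ()
    renaming (to to f; from to f⁻¹; strictlyInverseˡ to f∘f⁻¹; strictlyInverseʳ to f⁻¹∘f)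
  open Equivalence using (to; from)

  f-injective : ∀ {x y} → f x ≡ f y → x ≡ y
  f-injective {x} {y} fx≡fy = trans (sym (f⁻¹∘f x)) (trans (cong f⁻¹ fx≡fy) (f⁻¹∘f y))

  EnvRelated : (Fin n → A.C) → (Fin n → B.C) → Set
  EnvRelated ρA ρB = ∀ i → ρB i ≡ f (ρA i)

  SetEnvRelated : (Fin m → A.C → Set) → (Fin m → B.C → Set) → Set
  SetEnvRelated σA σB = ∀ X a → σA X a ⇔ σB X (f a)

  private
    ≡⇒⇔ : {P Q : Set} → P ≡ Q → P ⇔ Q
    ≡⇒⇔ {P} refl = ⇔-id P

    Lift-cong : ∀ {ℓ} {P Q : Set} → P ⇔ Q → Lift ℓ P ⇔ Lift ℓ Q
    Lift-cong P⇔Q = mk⇔ (λ (lift p) → lift (to P⇔Q p)) (λ (lift q) → lift (from P⇔Q q))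

    ▸-related : ∀ {ρA : Fin n → A.C} {ρB} → EnvRelated ρA ρB → ∀ a →
                EnvRelated (extend₀ ρA a) (extend₀ ρB (f a))
    ▸-related e a fzero    = refl
    ▸-related e a (fsuc i) = e i

    extend-related : ∀ {σA : Fin m → A.C → Set} {σB X Y} → SetEnvRelated σA σB →
                     (∀ a → X a ⇔ Y (f a)) → SetEnvRelated (extend σA X) (extend σB Y)
    extend-related r X⇔Y fzero    = X⇔Y
    extend-related r X⇔Y (fsuc i) = r i

    pushforward-related : ∀ (X : A.C → Set) a → X a ⇔ X (f⁻¹ (f a))
    pushforward-related X a = ≡⇒⇔ (cong X (sym (f⁻¹∘f a)))

  sat-≅ : ∀ (φ : Form n m) {ρA ρB σA σB} → EnvRelated ρA ρB → SetEnvRelated σA σB →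
          Sat A φ ρA σA ⇔ Sat B φ ρB σB
  sat-≅ (i ≐ j) e r = Lift-cong (mk⇔
    (λ p → trans (e i) (trans (cong f p) (sym (e j))))
    (λ q → f-injective (trans (sym (e i)) (trans q (e j)))))
  sat-≅ (i ≼ j) {ρA} e r =
    Lift-cong (≡⇒⇔ (cong₂ B.R (sym (e i)) (sym (e j))) ⇔-∘ presR (ρA i) (ρA j))
  sat-≅ (inN₀ i) {ρA} e r = Lift-cong (≡⇒⇔ (cong B.P₀ (sym (e i))) ⇔-∘ presP₀ (ρA i))
  sat-≅ (inN₁ i) {ρA} e r = Lift-cong (≡⇒⇔ (cong B.P₁ (sym (e i))) ⇔-∘ presP₁ (ρA i))
  sat-≅ (i ∈ˢ X) {ρA} {σB = σB} e r =
    Lift-cong (≡⇒⇔ (cong (σB X) (sym (e i))) ⇔-∘ r X (ρA i))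
  sat-≅ (¬ᶠ φ) e r = ¬-cong-⇔ (sat-≅ φ e r)
  sat-≅ (φ ∧ᶠ ψ) e r = sat-≅ φ e r ×-⇔ sat-≅ ψ e r
  sat-≅ (φ ∨ᶠ ψ) e r = sat-≅ φ e r ⊎-⇔ sat-≅ ψ e r
  sat-≅ (φ ⇒ᶠ ψ) e r = →-cong-⇔ (sat-≅ φ e r) (sat-≅ ψ e r)
  sat-≅ (∃¹ φ) {ρB = ρB} {σB = σB} e r = mk⇔
    (λ (a , p) → f a , to (sat-≅ φ (▸-related e a) r) p)
    (λ (b , q) → f⁻¹ b , from (sat-≅ φ (▸-related e (f⁻¹ b)) r)
                           (subst (λ b′ → Sat B φ (extend₀ ρB b′) σB) (sym (f∘f⁻¹ b)) q))
  sat-≅ (∀¹ φ) {ρB = ρB} {σB = σB} e r = mk⇔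
    (λ p b → subst (λ b′ → Sat B φ (extend₀ ρB b′) σB) (f∘f⁻¹ b)
               (to (sat-≅ φ (▸-related e (f⁻¹ b)) r) (p (f⁻¹ b))))
    (λ q a → from (sat-≅ φ (▸-related e a) r) (q (f a)))
  sat-≅ (∃² φ) e r = mk⇔
    (λ (X , p) → (λ b → X (f⁻¹ b)) , to (sat-≅ φ e (extend-related r (pushforward-related X))) p)
    (λ (Y , q) → (λ a → Y (f a)) , from (sat-≅ φ e (extend-related r λ _ → ⇔-id _)) q)
  sat-≅ (∀² φ) e r = mk⇔
    (λ p Y → to (sat-≅ φ e (extend-related r λ _ → ⇔-id _)) (p (λ a → Y (f a))))
    (λ q X → from (sat-≅ φ e (extend-related r (pushforward-related X))) (q (λ b → X (f⁻¹ b))))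

  models-≅ : (φ : Sentence) → Models A φ ⇔ Models B φ
  models-≅ φ = sat-≅ φ (λ ()) (λ ())

even-or-odd : ∀ n → Even n ⊎ Even (suc n)
even-or-odd zero = inj₁ even0
even-or-odd (suc n) = Sum.swap (Sum.map₁ even+2 (even-or-odd n))

even⇒¬odd : ∀ {n} → Even n → ¬ Even (suc n)
even⇒¬odd even0 ()
even⇒¬odd (even+2 e) (even+2 o) = even⇒¬odd e o

odd⇔¬even : ∀ n → Even (suc n) ⇔ (¬ Even n)
odd⇔¬even n = mk⇔ (λ odd even → even⇒¬odd even odd)
  λ ¬even → Sum.[ (λ even → ⊥-elim (¬even even)) , (λ odd → odd) ]′ (even-or-odd n)

module SBJ⇒Axioms (em : ExcludedMiddle (lsuc 0ℓ)) (J : SBJTree) where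

  open SBJTree J
  open JoinTreeProperties tree
  open Structuring strct
  open IsSBJ isSBJ
  open MSSemantics (S J)
  open Classical em
  open Equivalence using (to; from)

  Coloured : N → Set
  Coloured = Str.P₀ (S J)

  lineOf : N → I
  lineOf x = proj₁ (cover x)

  inLine : ∀ x → U (lineOf x) x
  inLine x = proj₂ (cover x)

  depth-unique : ∀ {x a b} → Depth _≤_ U axis x a → Depth _≤_ U axis x b → a ≡ b
  depth-unique (atAxis _) (atAxis _) = refl
  depth-unique (atAxis u) (step u′ ne _ _) = ⊥-elim (ne (disjoint u′ u))
  depth-unique (step u ne _ _) (atAxis u′) = ⊥-elim (ne (disjoint u u′))
  depth-unique (step u _ top d) (step u′ _ top′ d′) with disjoint u u′
  ... | refl with top-unique top top′
  ... | refl = cong suc (depth-unique d d′)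

  depth-along-line : ∀ {i x y n} → U i x → U i y → Depth _≤_ U axis x n → Depth _≤_ U axis y n
  depth-along-line ux uy (atAxis u) with disjoint ux u
  ... | refl = atAxis uy
  depth-along-line ux uy (step u ne top d) with disjoint ux u
  ... | refl = step uy ne top d

  coloured⇔even : ∀ {x n} → Depth _≤_ U axis x n → Coloured x ⇔ Even n
  coloured⇔even dx = mk⇔ (λ (_ , dx′ , even) → subst Even (depth-unique dx′ dx) even)
                         (λ even → _ , dx , even)

  depth-step-recolours : ∀ {x t n} → Depth _≤_ U axis x (suc n) → Depth _≤_ U axis t n →
                         ¬ SameColour x t
  depth-step-recolours dx dt (x⇒t , t⇒x) with even-or-odd _
  ... | inj₁ even = even⇒¬odd even (to (coloured⇔even dx) (t⇒x (from (coloured⇔even dt) even)))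
  ... | inj₂ odd = even⇒¬odd (to (coloured⇔even dt) (x⇒t (from (coloured⇔even dx) odd))) odd

  line-top-recolours : ∀ {i x t} → U i x → i ≢ axis → IsTop _≤_ (U i) t → ¬ SameColour x t
  line-top-recolours ux i≢axis top =
    let n , dt = finiteDepth _ in depth-step-recolours (step ux i≢axis top dt) dt

  sameColour-along-line : ∀ {i a b} → U i a → U i b → SameColour a b
  sameColour-along-line ua ub = (λ (n , d , e) → n , depth-along-line ua ub d , e)
                              , (λ (n , d , e) → n , depth-along-line ub ua d , e)

  inLine⇒sameLine : ∀ {i x y} → U i x → U i y → SameLine x y
  inLine⇒sameLine {i} ux uy with proj₁ (lines i) _ _ ux uy
  ... | inj₁ x≤y = inj₁ (x≤y , λ w x≤w w≤y →
                     sameColour-along-line (proj₂ (lines i) _ w _ ux uy x≤w w≤y) ux)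
  ... | inj₂ y≤x = inj₂ (y≤x , λ w y≤w w≤x →
                     sameColour-along-line (proj₂ (lines i) _ w _ uy ux y≤w w≤x) uy)

  top-below-outside : ∀ {i x y t} → U i x → IsTop _≤_ (U i) t → x ≤ y → ¬ U i y → t ≤ y
  top-below-outside {i} {x} {y} ux (_ , least) x≤y y∉i = least y below-y
    where
    below-y : StrictUB _≤_ (U i) y
    below-y l ul with proj₁ (lines i) l x ul ux
    ... | inj₁ l≤x = ≤-trans l≤x x≤y , λ { refl → y∉i ul }
    ... | inj₂ x≤l with upLinear x l y x≤l x≤y
    ... | inj₁ l≤y = l≤y , λ { refl → y∉i ul }
    ... | inj₂ y≤l = ⊥-elim (y∉i (proj₂ (lines i) x y l ux ul x≤y y≤l))

  -- A monochrome interval cannot pass the top of a line, where the colour changes.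
  monochrome⇒inLine : ∀ {i x y} → U i x → x ≤ y → Monochrome x y → U i y
  monochrome⇒inLine {i} {x} {y} ux x≤y mono with dec (U i y)
  ... | yes uy = uy
  ... | no y∉i with dec (i ≡ axis)
  ... | yes refl = ⊥-elim (y∉i (axisUp x y ux x≤y))
  ... | no i≢axis =
        let t , top = tops i i≢axis
        in ⊥-elim (line-top-recolours ux i≢axis top
                     (swap (mono t (proj₁ (proj₁ top x ux)) (top-below-outside ux top x≤y y∉i))))

  sameLine⇒inLine : ∀ {i x y} → SameLine x y → U i x → U i y
  sameLine⇒inLine (inj₁ (x≤y , mono)) ux = monochrome⇒inLine ux x≤y mono
  sameLine⇒inLine {y = y} (inj₂ (y≤x , mono)) ux =
    subst (λ j → U j y) (disjoint (monochrome⇒inLine (inLine y) y≤x mono) ux) (inLine y)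

  top⇔ : ∀ {i x t} → U i x → IsTop _≤_ (SameLine x) t ⇔ IsTop _≤_ (U i) t
  top⇔ ux = mk⇔ (IsTop-cong (λ s → sameLine⇒inLine s ux) (inLine⇒sameLine ux))
                (IsTop-cong (inLine⇒sameLine ux) (λ s → sameLine⇒inLine s ux))

  axis⇒onAxis : ∀ {x} → U axis x → OnAxis x
  axis⇒onAxis u b x≤b = inLine⇒sameLine u (axisUp _ b u x≤b)

  onAxis⇒axis : ∀ {x} → OnAxis x → U axis x
  onAxis⇒axis {x} ax = subst (λ i → U i x) (axisUnique (lineOf x) up-closed) (inLine x)
    where
    up-closed : UpClosed _≤_ (U (lineOf x))
    up-closed a b ua a≤b with proj₁ (lines (lineOf x)) x a (inLine x) ua
    ... | inj₁ x≤a = sameLine⇒inLine (ax b (≤-trans x≤a a≤b)) (inLine x)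
    ... | inj₂ a≤x with upLinear a x b a≤x a≤b
    ... | inj₁ x≤b = sameLine⇒inLine (ax b x≤b) (inLine x)
    ... | inj₂ b≤x = proj₂ (lines (lineOf x)) a b x ua (inLine x) a≤b b≤x

  topped⇒≢axis : ∀ {i t} → IsTop _≤_ (U i) t → i ≢ axis
  topped⇒≢axis top refl = top-not-up-closed axisUp (proj₂ (nonempty axis)) top

  climb : ∀ {x n} (X : N → Set) →
          (∀ {y t} → X y → ¬ OnAxis y → IsTop _≤_ (SameLine y) t → X t) →
          Depth _≤_ U axis x n → X x → ∃ λ y → X y × OnAxis y
  climb X closed (atAxis u) Xx = _ , Xx , axis⇒onAxis u
  climb X closed (step u i≢axis top d) Xx =
    climb X closed d (closed Xx (λ ax → i≢axis (disjoint u (onAxis⇒axis ax))) (from (top⇔ u) top))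

  S-axioms : SBJAxioms (S J)
  S-axioms = record
    { ≤-refl         = ≤-refl
    ; ≤-trans        = ≤-trans
    ; ≤-antisym      = ≤-antisym
    ; upLinear       = upLinear
    ; joins          = joins
    ; degAtMost2     = isBJ
    ; inhabited      = inhabited
    ; P₁⇔¬P₀         = λ x → ⇔-id _
    ; sameLine-trans = λ {x} p q →
        inLine⇒sameLine (inLine x) (sameLine⇒inLine q (sameLine⇒inLine p (inLine x)))
    ; coloured-axis  = let x , u = nonempty axis in x , axis⇒onAxis u , zero , atAxis u , even0
    ; top-exists     = λ {x} ¬ax →
        let t , top = tops (lineOf x) λ e → ¬ax (axis⇒onAxis (subst (λ i → U i x) e (inLine x)))
        in t , from (top⇔ (inLine x)) top
    ; top-injective  = λ {x} {y} top-x top-y →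
        let e = topOfOne _ _ _ (to (top⇔ (inLine x)) top-x) (to (top⇔ (inLine y)) top-y)
        in inLine⇒sameLine (inLine x) (subst (λ i → U i y) (sym e) (inLine y))
    ; least-degree   = λ {m} ax least → let um = onAxis⇒axis ax in
        axisLeastDeg m (um , λ y uy → least y (inLine⇒sameLine um uy))
    ; top-recoloured = λ {x} top → let top′ = to (top⇔ (inLine x)) top in
        line-top-recolours (inLine x) (topped⇒≢axis top′) top′
    ; axis-reachable = λ x X Xx closed → climb X closed (proj₂ (finiteDepth x)) Xx
    }

module Axioms⇒SBJ (em : ExcludedMiddle (lsuc 0ℓ)) (M : Str) (A : SBJAxioms M) where

  open Str M
  open MSSemantics M
  open SBJAxioms A
  open Classical em
  open Equivalence using (to; from)

  tree : JoinTree
  tree = record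
    { N = C ; _≤_ = R ; countable = countable ; inhabited = inhabited
    ; ≤-refl = ≤-refl ; ≤-trans = ≤-trans ; ≤-antisym = ≤-antisym
    ; upLinear = upLinear ; joins = joins }

  open JoinTreeProperties tree using (x≤x⊔y; y≤x⊔y)

  sameLine-refl : ∀ x → SameLine x x
  sameLine-refl x = inj₁ (≤-refl x , λ w x≤w w≤x →
    subst (λ w → SameColour w x) (≤-antisym x≤w w≤x) ((λ p → p) , (λ p → p)))

  sameLine-sym : ∀ {x y} → SameLine x y → SameLine y x
  sameLine-sym (inj₁ p) = inj₂ p
  sameLine-sym (inj₂ p) = inj₁ p

  sameLine-comparable : ∀ {x y} → SameLine x y → (R x y) ⊎ (R y x)
  sameLine-comparable = Sum.map proj₁ proj₁

  sameLine-convex : ∀ {x y z} → SameLine x z → R x y → R y z → SameLine x y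
  sameLine-convex (inj₁ (_ , mono)) x≤y y≤z =
    inj₁ (x≤y , λ w x≤w w≤y → mono w x≤w (≤-trans w≤y y≤z))
  sameLine-convex {x} (inj₂ (z≤x , _)) x≤y y≤z =
    subst (SameLine x) (≤-antisym x≤y (≤-trans y≤z z≤x)) (sameLine-refl x)

  sameLine⇒sameColour : ∀ {x y} → SameLine x y → SameColour x y
  sameLine⇒sameColour (inj₁ (x≤y , mono)) = swap (mono _ x≤y (≤-refl _))
  sameLine⇒sameColour (inj₂ (y≤x , mono)) = mono _ y≤x (≤-refl _)

  root : C
  root = proj₁ coloured-axis

  root-onAxis : OnAxis root
  root-onAxis = proj₁ (proj₂ coloured-axis)

  onAxis⇒sameLine-root : ∀ {x} → OnAxis x → SameLine root x
  onAxis⇒sameLine-root {x} ax =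
    sameLine-trans (root-onAxis _ (x≤x⊔y root x)) (sameLine-sym (ax _ (y≤x⊔y root x)))

  sameLine-root⇒onAxis : ∀ {x} → SameLine root x → OnAxis x
  sameLine-root⇒onAxis (inj₁ (root≤x , mono)) y x≤y =
    sameLine-trans (sameLine-sym (inj₁ (root≤x , mono))) (root-onAxis y (≤-trans root≤x x≤y))
  sameLine-root⇒onAxis {x} (inj₂ (x≤root , mono)) y x≤y with upLinear x root y x≤root x≤y
  ... | inj₁ root≤y = sameLine-trans (inj₁ (x≤root , mono)) (root-onAxis y root≤y)
  ... | inj₂ y≤root = inj₁ (x≤y , λ w x≤w w≤y → mono w x≤w (≤-trans w≤y y≤root))

  Depth′ : C → ℕ → Set
  Depth′ = ClassDepth R SameLine root

  -- The induction axiom gives finite depth: the nodes of no depth are closed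
  -- under taking tops, so they would reach the axis.
  depth : ∀ x → ∃ (Depth′ x)
  depth x = dne λ no-depth →
    let y , ¬depth-y , ax = axis-reachable x (λ y → ¬ ∃ (Depth′ y)) no-depth
          λ ¬depth-y ¬ax top (n , d) →
            ¬depth-y (suc n , belowTop (λ s → ¬ax (sameLine-root⇒onAxis s)) top d)
    in ¬depth-y (zero , onAxis (onAxis⇒sameLine-root ax))

  lineEquivalence : LineEquivalence tree
  lineEquivalence = record
    { _∼_           = SameLine
    ; ∼-refl        = sameLine-refl
    ; ∼-sym         = sameLine-sym
    ; ∼-trans       = sameLine-trans
    ; ∼-comparable  = sameLine-comparable
    ; ∼-convex      = sameLine-convex
    ; root          = root
    ; root-up       = root-onAxis _
    ; top-exists    = λ ¬root∼x → top-exists λ ax → ¬root∼x (onAxis⇒sameLine-root ax)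
    ; top-injective = top-injective
    ; least-degree  = λ (root∼m , m-least) → least-degree (sameLine-root⇒onAxis root∼m)
                        λ y m∼y → m-least y (sameLine-trans root∼m m∼y)
    ; depth         = depth
    }

  open LineEquivalence⇒Structuring em tree lineEquivalence

  sbjTree : SBJTree
  sbjTree = record { tree = tree ; isBJ = degAtMost2 ; strct = structuring ; isSBJ = structuring-isSBJ }

  recoloured⇒opposite : ∀ {x y} → ¬ SameColour x y → P₀ x ⇔ (¬ P₀ y)
  recoloured⇒opposite ¬same = mk⇔
    (λ px py → ¬same ((λ _ → py) , (λ _ → px)))
    (λ ¬py → dne λ ¬px → ¬same ((λ px → ⊥-elim (¬px px)) , (λ py → ⊥-elim (¬py py))))

  coloured⇔even : ∀ {x n} → Depth′ x n → P₀ x ⇔ Even n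
  coloured⇔even (onAxis root∼x) = mk⇔ (λ _ → even0)
    λ _ → proj₁ (sameLine⇒sameColour root∼x) (proj₂ (proj₂ coloured-axis))
  coloured⇔even {n = suc n} (belowTop _ top d) =
    ⇔-sym (odd⇔¬even n) ⇔-∘
      (¬-cong-⇔ (coloured⇔even d) ⇔-∘ recoloured⇒opposite (top-recoloured top))

  ≅S : M ≅ S sbjTree
  ≅S = record
    { bij    = ↔-id C
    ; presR  = λ x y → ⇔-id _
    ; presP₀ = coloured⇔coloured
    ; presP₁ = λ x → ¬-cong-⇔ (coloured⇔coloured x) ⇔-∘ P₁⇔¬P₀ x
    }
    where
    coloured⇔coloured : ∀ x → P₀ x ⇔ Str.P₀ (S sbjTree) x
    coloured⇔coloured x = mk⇔
      (λ px → let n , d = depth x in n , classDepth⇒Depth d , to (coloured⇔even d) px)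
      (λ (n , d , even) → from (coloured⇔even (Depth⇒classDepth d)) even)

proposition3p9 : ExcludedMiddle (lsuc 0ℓ) →
    ((T : JoinTree) → IsBJ T → Σ (Structuring T) (λ 𝒰 → IsSBJ T 𝒰))
    × Σ Sentence (λ φ → (M : Str) →
        (Models M φ → Σ SBJTree (λ J → M ≅ S J))
        × (Σ SBJTree (λ J → M ≅ S J) → Models M φ))
proposition3p9 em = BJ⇒SBJ em , sbjSentence , λ M →
  (λ M⊨φ → let open Axioms⇒SBJ em M (models⇒axioms M M⊨φ) in sbjTree , ≅S) ,
  (λ (J , M≅SJ) → Equivalence.from (IsomorphismInvariance.models-≅ M≅SJ sbjSentence)
                    (axioms⇒models (S J) (SBJ⇒Axioms.S-axioms em J)))
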